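{- Let $d,n\in\mathbb N$. Suppose that $G$ is a graph on $n\ge 2d$ vertices with minimum degree $\delta(G)\ge d$. Let $X\subseteq V(G)$ with $|X|=d$. Then $G$ contains a matching of exactly $d$ edges that covers all vertices in $X$.
   Context: A matching is a set of vertex-disjoint edges. -}

module Defs where

open import Level using (Level; _⊔_) renaming (suc to lsuc; zero to lzero)
open import Data.Nat using (ℕ; _≤_; _*_)
open import Data.Fin using (Fin)
open import Data.Fin.Subset using (Subset; _∈_)
open import Data.List using (List; length; filter; concatMap; _∷_; [])
open import Data.List.Membership.Propositional renaming (_∈_ to _∈ₗ_)
open import Data.List.Relation.Unary.Unique.Propositional using (Unique)
open import Data.List.Base using (allFin)
open import Data.Product using (Σ; _×_; _,_; proj₁; proj₂)
open import Relation.Nullary using (¬_; Dec)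
open import Relation.Unary using (Decidable)
open import Relation.Binary.PropositionalEquality using (_≡_)

record Graph (n : ℕ) : Set₁ where
  field
    Adj     : Fin n → Fin n → Set
    adj?    : (u v : Fin n) → Dec (Adj u v)
    irrefl  : ∀ v → ¬ Adj v v
    sym     : ∀ {u v} → Adj u v → Adj v u

open Graph public

neighbours : ∀ {n} (G : Graph n) → Fin n → List (Fin n)
neighbours G v = filter (adj? G v) (allFin _)

degree : ∀ {n} (G : Graph n) → Fin n → ℕ
degree G v = length (neighbours G v)

MinDegreeAtLeast : ∀ {n} → Graph n → ℕ → Set
MinDegreeAtLeast G d = ∀ v → d ≤ degree G v

-- An edge of G: an ordered pair of adjacent vertices (orientation irrelevant).
Edge : ∀ {n} → Graph n → Set
Edge {n} G = Σ (Fin n × Fin n) λ p → Adj G (proj₁ p) (proj₂ p)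

endpoints : ∀ {n} (G : Graph n) → List (Edge G) → List (Fin n)
endpoints G [] = []
endpoints G (((u , v) , _) ∷ es) = u ∷ v ∷ endpoints G es

-- A matching: a list of edges that are pairwise vertex-disjoint, i.e. the list
-- of all endpoints has no repetitions (so also the edges are distinct).
IsMatching : ∀ {n} (G : Graph n) → List (Edge G) → Set
IsMatching G M = Unique (endpoints G M)

Covers : ∀ {n} (G : Graph n) → List (Edge G) → Subset n → Set
Covers G M X = ∀ x → x ∈ X → x ∈ₗ endpoints G M

module Submission where

-- The engine is an averaging
-- lemma (pigeonhole: Σ g < Σ f over a list forces g e < f e for one entry e).
--  1. Growth: if |M| < d there are free vertices u ≠ v.  Either one has a free
--     neighbour, or u, v send ≥ 2d > 2|M| edges into V(M), so some ab ∈ M sees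
--     three of them and is exchanged for ua, vb (or ub, va).
--  2. Covering: if |M| = d and x ∈ X is free, fewer than d covered vertices lie
--     in X.  With a free neighbour w, an edge of M avoiding X is exchanged for
--     xw; otherwise some ab has x ~ a and b ∉ X and is exchanged for xa.
-- Growing the empty matching to size d and then covering at most d more
-- vertices of X proves the theorem.

open import Defs hiding (sym)
open import Level using (Level)
open import Data.Nat using (ℕ; zero; suc; _+_; _*_; _≤_; _<_; z≤n; s≤s)
open import Data.Nat.Properties
  using (≤-refl; ≤-trans; ≤-reflexive; <-≤-trans; <-irrefl; ≮⇒≥; n<1+n; n≤1+n;
         m≤m+n; +-mono-≤; +-monoˡ-≤; +-monoˡ-<; +-monoʳ-≤; +-cancelˡ-<; +-assoc; +-comm;
         +-suc; +-identityʳ; *-zeroʳ; *-suc; *-monoʳ-≤; *-monoʳ-<; _<?_; module ≤-Reasoning)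
open import Data.Nat.ListAction using (sum)
open import Data.Nat.ListAction.Properties using (sum-↭)
open import Data.Nat.Tactic.RingSolver using (solve-∀)
open import Data.Fin as Fin using (Fin) renaming (_≟_ to _≟ᶠ_)
open import Data.Fin.Properties using (any?)
open import Data.Fin.Subset using (Subset; ∣_∣; _∈_; inside; outside)
open import Data.Fin.Subset.Properties using (_∈?_; drop-there)
import Data.Vec.Base as Vec
open import Data.Vec.Base using ([]; _∷_)
open import Data.List using (List; []; _∷_; length; map; filter; tabulate; allFin)
open import Data.List.Properties using (length-tabulate)
open import Data.List.Membership.Propositional using () renaming (_∈_ to _∈ₗ_; _∉_ to _∉ₗ_)
open import Data.List.Membership.Propositional.Properties using (∈-filter⁺; ∈-filter⁻; ∈-allFin)
open import Data.List.Relation.Unary.Any using (Any; here; there)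
import Data.List.Relation.Unary.All as All
open import Data.List.Relation.Unary.All.Properties using (¬Any⇒All¬)
open import Data.List.Relation.Unary.AllPairs using ([]; _∷_)
open import Data.List.Relation.Unary.Unique.Propositional using (Unique)
open import Data.List.Relation.Unary.Unique.Propositional.Properties
  using (allFin⁺; filter⁺; Unique[x∷xs]⇒x∉xs)
open import Data.List.Relation.Binary.Permutation.Propositional
  using (_↭_; ↭-refl; ↭-prep; ↭-swap; ↭-trans; ↭-sym; ↭⇒↭ₛ)
import Data.List.Relation.Binary.Permutation.Propositional as ↭
open import Data.List.Relation.Binary.Permutation.Propositional.Properties
  using (↭-length; ∈-resp-↭; map⁺; ++-comm; ++⁺ʳ)
import Data.List.Relation.Binary.Permutation.Setoid.Properties as Permₛ
open import Data.Product using (Σ; ∃; ∃₂; _×_; _,_; proj₁; proj₂)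
open import Data.Sum using (_⊎_; inj₁; inj₂)
open import Data.Empty using (⊥-elim)
open import Relation.Nullary using (¬_; Dec; yes; no; ¬?; _×-dec_)
open import Relation.Nullary.Decidable using (decidable-stable)
open import Relation.Unary using (Pred; Decidable)
open import Relation.Binary.PropositionalEquality
  using (_≡_; _≢_; refl; sym; trans; cong; subst; setoid; module ≡-Reasoning)

private
  variable
    a p q r s : Level
    A : Set a
    P : Set p
    Q : Set q
    R : Set r
    S : Set s

⟦_⟧ : Dec P → ℕ
⟦ yes _ ⟧ = 1
⟦ no _ ⟧ = 0

⟦⟧-yes : (d : Dec P) → P → ⟦ d ⟧ ≡ 1
⟦⟧-yes (yes _) _ = refl
⟦⟧-yes (no ¬p) p = ⊥-elim (¬p p)

⟦⟧-no : (d : Dec P) → ¬ P → ⟦ d ⟧ ≡ 0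
⟦⟧-no (yes p) ¬p = ⊥-elim (¬p p)
⟦⟧-no (no _) _ = refl

⟦⟧-mono : (p? : Dec P) (q? : Dec Q) → (P → Q) → ⟦ p? ⟧ ≤ ⟦ q? ⟧
⟦⟧-mono (yes p) q? p⇒q = ≤-reflexive (sym (⟦⟧-yes q? (p⇒q p)))
⟦⟧-mono (no _) q? _ = z≤n

⟦⟧-exclusive : (p? : Dec P) (q? : Dec Q) → ¬ (P × Q) → ⟦ p? ⟧ + ⟦ q? ⟧ ≤ 1
⟦⟧-exclusive (yes p) (yes q) ¬pq = ⊥-elim (¬pq (p , q))
⟦⟧-exclusive (yes _) (no _) _ = ≤-refl
⟦⟧-exclusive (no _) (yes _) _ = ≤-refl
⟦⟧-exclusive (no _) (no _) _ = z≤n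

-- Four indicators summing to at least 3 force one of two "crossing" pairs:
-- this is how an edge ab seeing three of u~a, u~b, v~a, v~b is exchanged.
three-of-four : (p? : Dec P) (q? : Dec Q) (r? : Dec R) (s? : Dec S) →
                2 < (⟦ p? ⟧ + ⟦ q? ⟧) + (⟦ r? ⟧ + ⟦ s? ⟧) → (P × S) ⊎ (Q × R)
three-of-four p? q? r? s? three with p? ×-dec s? | q? ×-dec r?
... | yes ps | _ = inj₁ ps
... | no _ | yes qr = inj₂ qr
... | no ¬ps | no ¬qr = ⊥-elim (<-irrefl refl (<-≤-trans three at-most-two))
  where
    regroup : ∀ w x y z → (w + x) + (y + z) ≡ (w + z) + (x + y)
    regroup = solve-∀
    at-most-two : (⟦ p? ⟧ + ⟦ q? ⟧) + (⟦ r? ⟧ + ⟦ s? ⟧) ≤ 2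
    at-most-two = subst (_≤ 2) (sym (regroup ⟦ p? ⟧ ⟦ q? ⟧ ⟦ r? ⟧ ⟦ s? ⟧))
                    (+-mono-≤ (⟦⟧-exclusive p? s? ¬ps) (⟦⟧-exclusive q? r? ¬qr))

-- Indicators of P, Q exceeding those of R, S force P ∧ ¬S or Q ∧ ¬R; used with
-- P, Q = x ~ a, x ~ b and R, S = a ∈ X, b ∈ X.
crossing : (p? : Dec P) (q? : Dec Q) (r? : Dec R) (s? : Dec S) →
           ⟦ r? ⟧ + ⟦ s? ⟧ < ⟦ p? ⟧ + ⟦ q? ⟧ → (P × ¬ S) ⊎ (Q × ¬ R)
crossing p? q? r? s? more with p? ×-dec ¬? s? | q? ×-dec ¬? r?
... | yes p¬s | _ = inj₁ p¬s
... | no _ | yes q¬r = inj₂ q¬r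
... | no ¬p¬s | no ¬q¬r = ⊥-elim (<-irrefl refl (<-≤-trans more bounded))
  where
    bounded : ⟦ p? ⟧ + ⟦ q? ⟧ ≤ ⟦ r? ⟧ + ⟦ s? ⟧
    bounded = subst (⟦ p? ⟧ + ⟦ q? ⟧ ≤_) (+-comm ⟦ s? ⟧ ⟦ r? ⟧)
      (+-mono-≤ (⟦⟧-mono p? s? λ p → decidable-stable s? (λ ¬s → ¬p¬s (p , ¬s)))
                (⟦⟧-mono q? r? λ q → decidable-stable r? (λ ¬r → ¬q¬r (q , ¬r))))

count : {P : Pred A p} → Decidable P → List A → ℕ
count P? xs = length (filter P? xs)

count-∷ : {P : Pred A p} (P? : Decidable P) (x : A) (xs : List A) →
          count P? (x ∷ xs) ≡ ⟦ P? x ⟧ + count P? xs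
count-∷ P? x xs with P? x
... | yes _ = refl
... | no _ = refl

total : (A → ℕ) → List A → ℕ
total f xs = sum (map f xs)

total-↭ : (f : A → ℕ) {xs ys : List A} → xs ↭ ys → total f xs ≡ total f ys
total-↭ f xs↭ys = sum-↭ (map⁺ f xs↭ys)

total-+ : (f g : A → ℕ) (xs : List A) →
          total (λ x → f x + g x) xs ≡ total f xs + total g xs
total-+ f g [] = refl
total-+ f g (x ∷ xs) = trans (cong (f x + g x +_) (total-+ f g xs)) (shuffle (f x) (g x) _ _)
  where
    shuffle : ∀ a b c d → (a + b) + (c + d) ≡ (a + c) + (b + d)
    shuffle = solve-∀

total-const : (c : ℕ) (xs : List A) → total (λ _ → c) xs ≡ c * length xs
total-const c [] = sym (*-zeroʳ c)
total-const c (x ∷ xs) = trans (cong (c +_) (total-const c xs)) (sym (*-suc c (length xs)))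

pick : {P : Pred A p} {xs : List A} → Any P xs → ∃₂ λ x rest → P x × xs ↭ x ∷ rest
pick (here px) = _ , _ , px , ↭-refl
pick {xs = y ∷ _} (there later) with pick later
... | x , rest , px , xs↭ = x , y ∷ rest , px , ↭-trans (↭-prep y xs↭) (↭-swap y x ↭-refl)

exceeds-somewhere : (f g : A → ℕ) (xs : List A) → total g xs < total f xs →
                    Any (λ x → g x < f x) xs
exceeds-somewhere f g [] ()
exceeds-somewhere f g (x ∷ xs) more with g x <? f x
... | yes gx<fx = here gx<fx
... | no gx≮fx = there (exceeds-somewhere f g xs
        (+-cancelˡ-< (g x) _ _ (<-≤-trans more (+-monoˡ-≤ (total f xs) (≮⇒≥ gx≮fx)))))

pigeonhole : (f g : A → ℕ) (xs : List A) → total g xs < total f xs →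
             ∃₂ λ x rest → g x < f x × xs ↭ x ∷ rest
pigeonhole f g xs more = pick (exceeds-somewhere f g xs more)

unique-⊆-length : {xs ys : List A} → Unique xs → (∀ {z} → z ∈ₗ xs → z ∈ₗ ys) →
                  length xs ≤ length ys
unique-⊆-length {xs = []} _ _ = z≤n
unique-⊆-length {xs = y ∷ xs} {ys} (y≢xs ∷ uxs) xs⊆ys with pick (xs⊆ys (here refl))
... | .y , rest , refl , ys↭ =
  subst (suc (length xs) ≤_) (sym (↭-length ys↭)) (s≤s (unique-⊆-length uxs xs⊆rest))
  where
    xs⊆rest : ∀ {z} → z ∈ₗ xs → z ∈ₗ rest
    xs⊆rest z∈xs with ∈-resp-↭ ys↭ (xs⊆ys (there z∈xs))
    ... | here z≡y = ⊥-elim (All.lookup y≢xs z∈xs (sym z≡y))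
    ... | there z∈rest = z∈rest

exchange-increases : (h : A → ℕ) {xs rest : List A} {x x′ : A} →
                     xs ↭ x ∷ rest → h x < h x′ → total h xs < total h (x′ ∷ rest)
exchange-increases h {rest = rest} xs↭ more =
  subst (_< _) (sym (total-↭ h xs↭)) (+-monoˡ-< (total h rest) more)

subset-size : ∀ {m} {P : Pred A p} (P? : Decidable P) (X : Subset m) (f : Fin m → A) →
              (∀ i → i ∈ X → P (f i)) → (∀ i → P (f i) → i ∈ X) →
              count P? (tabulate f) ≡ ∣ X ∣
subset-size P? [] f _ _ = refl
subset-size {A = A} {m = suc m} {P = P} P? (b ∷ X) f into out = begin
  count P? (tabulate f)                        ≡⟨ count-∷ P? (f Fin.zero) _ ⟩
  ⟦ P? (f Fin.zero) ⟧ + count P? (tabulate f₊) ≡⟨ cong (⟦ P? (f Fin.zero) ⟧ +_) tail-size ⟩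
  ⟦ P? (f Fin.zero) ⟧ + ∣ X ∣                  ≡⟨ head-indicator b into out ⟩
  ∣ b ∷ X ∣                                    ∎
  where
    open ≡-Reasoning
    f₊ : Fin m → A
    f₊ i = f (Fin.suc i)

    tail-size : count P? (tabulate f₊) ≡ ∣ X ∣
    tail-size = subset-size P? X f₊
      (λ i i∈X → into (Fin.suc i) (Vec.there i∈X)) (λ i pfi → drop-there (out (Fin.suc i) pfi))

    head-indicator : ∀ b → (∀ i → i ∈ b ∷ X → P (f i)) → (∀ i → P (f i) → i ∈ b ∷ X) →
                     ⟦ P? (f Fin.zero) ⟧ + ∣ X ∣ ≡ ∣ b ∷ X ∣
    head-indicator inside into _ =
      cong (_+ ∣ X ∣) (⟦⟧-yes (P? (f Fin.zero)) (into Fin.zero Vec.here))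
    head-indicator outside _ out =
      cong (_+ ∣ X ∣) (⟦⟧-no (P? (f Fin.zero)) (λ pf0 → zero∉ (out Fin.zero pf0)))
      where
        zero∉ : ¬ Fin.zero ∈ outside ∷ X
        zero∉ ()

module Matchings {n : ℕ} (G : Graph n) where
  open import Data.List.Membership.DecPropositional (_≟ᶠ_ {n}) using () renaming (_∈?_ to _∈ₗ?_)

  Free : List (Edge G) → Fin n → Set
  Free M v = v ∉ₗ endpoints G M

  endCount : {P : Pred (Fin n) p} → Decidable P → Edge G → ℕ
  endCount P? ((a , b) , _) = ⟦ P? a ⟧ + ⟦ P? b ⟧

  count-endpoints : {P : Pred (Fin n) p} (P? : Decidable P) (M : List (Edge G)) →
                    count P? (endpoints G M) ≡ total (endCount P?) M
  count-endpoints P? [] = refl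
  count-endpoints P? (((a , b) , _) ∷ M) = begin
    count P? (a ∷ b ∷ endpoints G M)                   ≡⟨ count-∷ P? a _ ⟩
    ⟦ P? a ⟧ + count P? (b ∷ endpoints G M)            ≡⟨ cong (⟦ P? a ⟧ +_) (count-∷ P? b _) ⟩
    ⟦ P? a ⟧ + (⟦ P? b ⟧ + count P? (endpoints G M))   ≡⟨ sym (+-assoc ⟦ P? a ⟧ _ _) ⟩
    (⟦ P? a ⟧ + ⟦ P? b ⟧) + count P? (endpoints G M)   ≡⟨ cong (_ +_) (count-endpoints P? M) ⟩
    (⟦ P? a ⟧ + ⟦ P? b ⟧) + total (endCount P?) M      ∎
    where open ≡-Reasoning

  endpoints-length : (M : List (Edge G)) → length (endpoints G M) ≡ 2 * length M
  endpoints-length [] = refl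
  endpoints-length (_ ∷ M) =
    trans (cong (λ l → suc (suc l)) (endpoints-length M)) (sym (*-suc 2 (length M)))

  endpoints-↭ : {M M′ : List (Edge G)} → M ↭ M′ → endpoints G M ↭ endpoints G M′
  endpoints-↭ ↭.refl = ↭-refl
  endpoints-↭ (↭.prep ((a , b) , _) M↭) = ↭-prep a (↭-prep b (endpoints-↭ M↭))
  endpoints-↭ (↭.swap {xs = M} ((a , b) , _) ((c , d) , _) M↭) =
    ↭-trans (++⁺ʳ (endpoints G M) (++-comm (a ∷ b ∷ []) (c ∷ d ∷ [])))
            (↭-prep c (↭-prep d (↭-prep a (↭-prep b (endpoints-↭ M↭)))))
  endpoints-↭ (↭.trans M↭ M↭′) = ↭-trans (endpoints-↭ M↭) (endpoints-↭ M↭′)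

  matching-↭ : {M M′ : List (Edge G)} → M ↭ M′ → IsMatching G M → IsMatching G M′
  matching-↭ M↭ = Permₛ.Unique-resp-↭ (setoid (Fin n)) (↭⇒↭ₛ (endpoints-↭ M↭))

  free-≢ : {M : List (Edge G)} {v y : Fin n} → Free M v → y ∈ₗ endpoints G M → v ≢ y
  free-≢ v∉ y∈ refl = v∉ y∈

  free-∷ : {M : List (Edge G)} {v a b : Fin n} {ab : Adj G a b} →
           v ≢ a → v ≢ b → Free M v → Free (((a , b) , ab) ∷ M) v
  free-∷ v≢a _ _ (here v≡a) = v≢a v≡a
  free-∷ _ v≢b _ (there (here v≡b)) = v≢b v≡b
  free-∷ _ _ v∉ (there (there v∈)) = v∉ v∈

  add-edge : {M : List (Edge G)} {u w : Fin n} → IsMatching G M → Free M u → Free M w →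
             (uw : Adj G u w) → IsMatching G (((u , w) , uw) ∷ M)
  add-edge {M} {u} {w} isM u∉ w∉ uw = ¬Any⇒All¬ _ u∉w∷M ∷ (¬Any⇒All¬ _ w∉ ∷ isM)
    where
      u∉w∷M : u ∉ₗ w ∷ endpoints G M
      u∉w∷M (here u≡w) = irrefl G u (subst (Adj G u) (sym u≡w) uw)
      u∉w∷M (there u∈) = u∉ u∈

  module Removal {M rest : List (Edge G)} {a b : Fin n} {ab : Adj G a b}
                 (isM : IsMatching G M) (M↭ : M ↭ ((a , b) , ab) ∷ rest) where
    private
      unique-front : Unique (a ∷ b ∷ endpoints G rest)
      unique-front = matching-↭ M↭ isM

      from-front : {v : Fin n} → v ∈ₗ a ∷ b ∷ endpoints G rest → v ∈ₗ endpoints G M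
      from-front = ∈-resp-↭ (↭-sym (endpoints-↭ M↭))

    rest-matching : IsMatching G rest
    rest-matching with _ ∷ (_ ∷ unique-rest) ← unique-front = unique-rest

    a≢b : a ≢ b
    a≢b a≡b = Unique[x∷xs]⇒x∉xs unique-front (here a≡b)

    a-free : Free rest a
    a-free a∈ = Unique[x∷xs]⇒x∉xs unique-front (there a∈)

    b-free : Free rest b
    b-free with _ ∷ unique-b-rest ← unique-front = Unique[x∷xs]⇒x∉xs unique-b-rest

    a-covered : a ∈ₗ endpoints G M
    a-covered = from-front (here refl)

    b-covered : b ∈ₗ endpoints G M
    b-covered = from-front (there (here refl))

    free-in-rest : {v : Fin n} → Free M v → Free rest v
    free-in-rest v∉ v∈ = v∉ (from-front (there (there v∈)))

    rest-length : length M ≡ suc (length rest)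
    rest-length = ↭-length M↭

  free-vertex : (L : List (Fin n)) → length L < n → ∃ λ v → v ∉ₗ L
  free-vertex L short with any? (λ v → ¬? (v ∈ₗ? L))
  ... | yes found = found
  ... | no none = ⊥-elim (<-irrefl refl (<-≤-trans short all-listed))
    where
      all-listed : n ≤ length L
      all-listed = subst (_≤ length L) (length-tabulate (λ v → v))
        (unique-⊆-length (allFin⁺ n) λ {v} _ → decidable-stable (v ∈ₗ? L) (λ v∉ → none (v , v∉)))

  free-neighbour-or-saturated : (u : Fin n) (M : List (Edge G)) →
    (∃ λ w → Adj G u w × Free M w) ⊎ degree G u ≤ total (endCount (adj? G u)) M
  free-neighbour-or-saturated u M with any? (λ w → adj? G u w ×-dec ¬? (w ∈ₗ? endpoints G M))
  ... | yes found = inj₁ found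
  ... | no none = inj₂ (subst (degree G u ≤_) (count-endpoints (adj? G u) M)
          (unique-⊆-length (filter⁺ (adj? G u) (allFin⁺ n)) neighbours-covered))
    where
      neighbours-covered : ∀ {w} → w ∈ₗ neighbours G u → w ∈ₗ filter (adj? G u) (endpoints G M)
      neighbours-covered {w} w∈ =
        ∈-filter⁺ (adj? G u) (decidable-stable (w ∈ₗ? endpoints G M) λ w∉ → none (w , uw , w∉)) uw
        where
          uw : Adj G u w
          uw = proj₂ (∈-filter⁻ (adj? G u) {xs = allFin n} w∈)

  module Growth (d : ℕ) (room : 2 * d ≤ n) (δ : MinDegreeAtLeast G d) where

    Enlarged : List (Edge G) → Set
    Enlarged M = ∃ λ M′ → IsMatching G M′ × length M′ ≡ suc (length M)

    -- Exchange an edge ab of M for uy and vz, for free u ≠ v and distinct y, z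
    -- covered by M but free in the rest (in use, {y, z} = {a, b}).
    rematch : {M rest : List (Edge G)} {a b u v y z : Fin n} {ab : Adj G a b} →
              (isM : IsMatching G M) (M↭ : M ↭ ((a , b) , ab) ∷ rest) →
              Free M u → Free M v → u ≢ v →
              y ≢ z → Free rest y → Free rest z → y ∈ₗ endpoints G M → z ∈ₗ endpoints G M →
              Adj G u y → Adj G v z → Enlarged M
    rematch {rest = rest} {u = u} {v} {y} {z} isM M↭ u∉ v∉ u≢v y≢z y-free z-free y∈ z∈ uy vz =
      ((u , y) , uy) ∷ ((v , z) , vz) ∷ rest ,
      add-edge {((v , z) , vz) ∷ rest} (add-edge rest-matching (free-in-rest v∉) z-free vz)
        (free-∷ {ab = vz} u≢v (free-≢ u∉ z∈) (free-in-rest u∉))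
        (free-∷ {ab = vz} (λ y≡v → free-≢ v∉ y∈ (sym y≡v)) y≢z y-free) uy ,
      cong suc (sym rest-length)
      where open Removal isM M↭

    seen : Fin n → Fin n → Edge G → ℕ
    seen u v e = endCount (adj? G u) e + endCount (adj? G v) e

    crowded : {M : List (Edge G)} {u v : Fin n} → length M < d →
              degree G u ≤ total (endCount (adj? G u)) M →
              degree G v ≤ total (endCount (adj? G v)) M →
              total (λ _ → 2) M < total (seen u v) M
    crowded {M} {u} {v} small u-saturated v-saturated = begin-strict
      total (λ _ → 2) M                   ≡⟨ total-const 2 M ⟩
      2 * length M                        <⟨ *-monoʳ-< 2 small ⟩
      2 * d                               ≤⟨ +-mono-≤ (≤-trans (δ u) u-saturated) d+0≤ ⟩
      total (endCount (adj? G u)) M + total (endCount (adj? G v)) M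
                                          ≡⟨ sym (total-+ _ _ M) ⟩
      total (seen u v) M                  ∎
      where
        open ≤-Reasoning
        d+0≤ : d + 0 ≤ total (endCount (adj? G v)) M
        d+0≤ = ≤-trans (≤-reflexive (+-identityʳ d)) (≤-trans (δ v) v-saturated)

    room-for-two : {M : List (Edge G)} → length M < d → suc (length (endpoints G M)) < n
    room-for-two {M} small = begin
      suc (suc (length (endpoints G M))) ≡⟨ cong (λ l → suc (suc l)) (endpoints-length M) ⟩
      2 + 2 * length M                   ≡⟨ sym (*-suc 2 (length M)) ⟩
      2 * suc (length M)                 ≤⟨ *-monoʳ-≤ 2 small ⟩
      2 * d                              ≤⟨ room ⟩
      n                                  ∎
      where open ≤-Reasoning

    grow : {M : List (Edge G)} → IsMatching G M → length M < d → Enlarged M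
    grow {M} isM small
      with u , u∉ ← free-vertex (endpoints G M) (≤-trans (n≤1+n _) (room-for-two {M} small))
      with v , v∉u∷M ← free-vertex (u ∷ endpoints G M) (room-for-two {M} small)
      = grow-at u∉ (λ v∈ → v∉u∷M (there v∈)) (λ u≡v → v∉u∷M (here (sym u≡v)))
      where
        grow-at : {u v : Fin n} → Free M u → Free M v → u ≢ v → Enlarged M
        grow-at {u} {v} u∉ v∉ u≢v
          with free-neighbour-or-saturated u M | free-neighbour-or-saturated v M
        ... | inj₁ (w , uw , w∉) | _ = ((u , w) , uw) ∷ M , add-edge isM u∉ w∉ uw , refl
        ... | inj₂ _ | inj₁ (w , vw , w∉) = ((v , w) , vw) ∷ M , add-edge isM v∉ w∉ vw , refl
        ... | inj₂ u-saturated | inj₂ v-saturated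
          with ((a , b) , ab) , rest , three-seen , M↭
                 ← pigeonhole (seen u v) (λ _ → 2) M (crowded {M} small u-saturated v-saturated)
          with three-of-four (adj? G u a) (adj? G u b) (adj? G v a) (adj? G v b) three-seen
        ... | inj₁ (ua , vb) = rematch isM M↭ u∉ v∉ u≢v a≢b a-free b-free a-covered b-covered ua vb
          where open Removal isM M↭
        ... | inj₂ (ub , va) =
          rematch isM M↭ u∉ v∉ u≢v (λ b≡a → a≢b (sym b≡a)) b-free a-free b-covered a-covered ub va
          where open Removal isM M↭

    build : (k : ℕ) → k ≤ d → ∃ λ M → IsMatching G M × length M ≡ k
    build zero _ = [] , [] , refl
    build (suc k) k<d with M , isM , refl ← build k (≤-trans (n≤1+n k) k<d) = grow isM k<d

  module Covering (d : ℕ) (δ : MinDegreeAtLeast G d) (X : Subset n) (|X|≡d : ∣ X ∣ ≡ d) where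

    coverage : List (Edge G) → ℕ
    coverage = total (endCount (_∈? X))

    coverage-bound : {M : List (Edge G)} {x : Fin n} → IsMatching G M → x ∈ X → Free M x →
                     coverage M < d
    coverage-bound {M} {x} isM x∈X x∉ = begin-strict
      coverage M                            ≡⟨ sym (count-endpoints (_∈? X) M) ⟩
      count (_∈? X) (endpoints G M)         <⟨ unique-⊆-length unique-with-x with-x⊆X ⟩
      count (_∈? X) (allFin n)              ≡⟨ subset-size (_∈? X) X (λ i → i) (λ _ i∈ → i∈) (λ _ i∈ → i∈) ⟩
      ∣ X ∣                                 ≡⟨ |X|≡d ⟩
      d                                     ∎
      where
        open ≤-Reasoning
        unique-with-x : Unique (x ∷ filter (_∈? X) (endpoints G M))
        unique-with-x = ¬Any⇒All¬ _ (λ x∈ → x∉ (proj₁ (∈-filter⁻ (_∈? X) x∈))) ∷ filter⁺ (_∈? X) isM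
        with-x⊆X : ∀ {y} → y ∈ₗ x ∷ filter (_∈? X) (endpoints G M) → y ∈ₗ filter (_∈? X) (allFin n)
        with-x⊆X (here refl) = ∈-filter⁺ (_∈? X) (∈-allFin x) x∈X
        with-x⊆X (there y∈) =
          ∈-filter⁺ (_∈? X) (∈-allFin _) (proj₂ (∈-filter⁻ (_∈? X) {xs = endpoints G M} y∈))

    Improved : List (Edge G) → Set
    Improved M = ∃ λ M′ → IsMatching G M′ × length M′ ≡ length M × coverage M < coverage M′

    exchange : {M rest : List (Edge G)} {a b x y : Fin n} {ab : Adj G a b} →
               (isM : IsMatching G M) (M↭ : M ↭ ((a , b) , ab) ∷ rest) →
               Free M x → Free rest y → (xy : Adj G x y) →
               endCount (_∈? X) ((a , b) , ab) < endCount (_∈? X) ((x , y) , xy) → Improved M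
    exchange {rest = rest} {x = x} {y} isM M↭ x∉ y-free xy gain =
      ((x , y) , xy) ∷ rest , add-edge rest-matching (free-in-rest x∉) y-free xy ,
      sym rest-length , exchange-increases (endCount (_∈? X)) {x′ = ((x , y) , xy)} M↭ gain
      where open Removal isM M↭

    gain : {x y z : Fin n} → x ∈ X → ¬ z ∈ X → ⟦ y ∈? X ⟧ + ⟦ z ∈? X ⟧ < ⟦ x ∈? X ⟧ + ⟦ y ∈? X ⟧
    gain {x} {y} {z} x∈X z∉X = begin-strict
      ⟦ y ∈? X ⟧ + ⟦ z ∈? X ⟧  ≡⟨ cong (⟦ y ∈? X ⟧ +_) (⟦⟧-no (z ∈? X) z∉X) ⟩
      ⟦ y ∈? X ⟧ + 0           ≡⟨ +-identityʳ _ ⟩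
      ⟦ y ∈? X ⟧               <⟨ n<1+n _ ⟩
      1 + ⟦ y ∈? X ⟧           ≡⟨ cong (_+ ⟦ y ∈? X ⟧) (sym (⟦⟧-yes (x ∈? X) x∈X)) ⟩
      ⟦ x ∈? X ⟧ + ⟦ y ∈? X ⟧  ∎
      where open ≤-Reasoning

    few-in-X : {M : List (Edge G)} {x : Fin n} →
               IsMatching G M → length M ≡ d → x ∈ X → Free M x → coverage M < total (λ _ → 1) M
    few-in-X {M} isM |M|≡d x∈X x∉ =
      subst (coverage M <_) (sym (trans (total-const 1 M) (trans (+-identityʳ _) |M|≡d)))
        (coverage-bound isM x∈X x∉)

    improve : {M : List (Edge G)} {x : Fin n} →
              IsMatching G M → length M ≡ d → x ∈ X → Free M x → Improved M
    improve {M} {x} isM |M|≡d x∈X x∉ with free-neighbour-or-saturated x M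
    -- x has a free neighbour w: some edge of M misses X and is replaced by xw.
    ... | inj₁ (w , xw , w∉)
      with ((a , b) , ab) , rest , misses-X , M↭
             ← pigeonhole (λ _ → 1) (endCount (_∈? X)) M (few-in-X isM |M|≡d x∈X x∉)
      = exchange isM M↭ x∉ (free-in-rest w∉) xw
          (<-≤-trans misses-X (≤-trans (≤-reflexive (sym (⟦⟧-yes (x ∈? X) x∈X))) (m≤m+n _ _)))
      where open Removal isM M↭
    -- Every neighbour of x is covered: some edge ab has x ~ a and b ∉ X (or
    -- symmetrically), and is replaced by xa.
    ... | inj₂ x-saturated
      with ((a , b) , ab) , rest , more , M↭ ← pigeonhole (endCount (adj? G x)) (endCount (_∈? X)) M
             (<-≤-trans (coverage-bound isM x∈X x∉) (≤-trans (δ x) x-saturated))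
      with crossing (adj? G x a) (adj? G x b) (a ∈? X) (b ∈? X) more
    ... | inj₁ (xa , b∉X) = exchange isM M↭ x∉ a-free xa (gain x∈X b∉X)
      where open Removal isM M↭
    ... | inj₂ (xb , a∉X) =
      exchange isM M↭ x∉ b-free xb
        (subst (_< ⟦ x ∈? X ⟧ + ⟦ b ∈? X ⟧) (+-comm ⟦ b ∈? X ⟧ ⟦ a ∈? X ⟧) (gain x∈X a∉X))
      where open Removal isM M↭

    CoveringMatching : Set
    CoveringMatching = Σ (List (Edge G)) λ M → IsMatching G M × length M ≡ d × Covers G M X

    uncovered-or-covers : (M : List (Edge G)) → (∃ λ x → x ∈ X × Free M x) ⊎ Covers G M X
    uncovered-or-covers M with any? (λ x → x ∈? X ×-dec ¬? (x ∈ₗ? endpoints G M))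
    ... | yes found = inj₁ found
    ... | no none =
      inj₂ λ x x∈X → decidable-stable (x ∈ₗ? endpoints G M) (λ x∉ → none (x , x∈X , x∉))

    -- Improve until X is covered; since coverage stays below d while some
    -- x ∈ X is free, `rounds + coverage M ≥ d` guarantees enough rounds.
    saturate : (rounds : ℕ) (M : List (Edge G)) → IsMatching G M → length M ≡ d →
               d ≤ rounds + coverage M → CoveringMatching
    saturate rounds M isM |M|≡d enough with uncovered-or-covers M
    ... | inj₂ covers = M , isM , |M|≡d , covers
    saturate zero M isM |M|≡d enough | inj₁ (x , x∈X , x∉) =
      ⊥-elim (<-irrefl refl (<-≤-trans (coverage-bound isM x∈X x∉) enough))
    saturate (suc rounds) M isM |M|≡d enough | inj₁ (x , x∈X , x∉)
      with M′ , isM′ , same-size , better ← improve isM |M|≡d x∈X x∉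
      = saturate rounds M′ isM′ (trans same-size |M|≡d)
          (≤-trans enough (subst (_≤ rounds + coverage M′) (+-suc rounds _)
                                 (+-monoʳ-≤ rounds better)))

proposition10p3 : (d n : ℕ) → 2 * d ≤ n → (G : Graph n) → MinDegreeAtLeast G d →
    (X : Subset n) → ∣ X ∣ ≡ d →
    Σ (List (Edge G)) λ M → IsMatching G M × length M ≡ d × Covers G M X
-- Grow the empty matching to size d, then cover X in at most d rounds.
proposition10p3 d n 2d≤n G δ X |X|≡d
  with M , isM , |M|≡d ← Matchings.Growth.build G d 2d≤n δ d ≤-refl
  = Matchings.Covering.saturate G d δ X |X|≡d d M isM |M|≡d (m≤m+n d _)
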